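{- Let $P$ be a finite poset with a unique minimum and a unique maximum, and let $d$ be the dimension of $P$. Let $h_{1},\dots,h_{d}$ be positive integers and let $H=[h_{1}]\times\dots\times[h_{d}]$ with the pointwise order. Then $H$ contains a family $\mathcal{P}$ of pairwise disjoint copies of $P$ with the following properties: (1) the members of $\mathcal{P}$ cover at least $(h_{1}-|P|)\cdots(h_{d}-|P|)$ elements of $H$; (2) the set of minimum elements of the members of $\mathcal{P}$ and the set of maximum elements of the members of $\mathcal{P}$ each form a grid of size $\lfloor h_{1}/|P|\rfloor\times(h_{2}-|P|)\times\dots\times(h_{d}-|P|)$.
   Context: A subset $Q'$ of a poset $Q$ is a copy of $P$ if the induced subposet on $Q'$ is isomorphic to $P$. The dimension of $P$ is the smallest $d$ such that there exist bijections $\pi_1,\dots,\pi_d:P\to[|P|]$ with $p\le_P q$ iff $\pi_i(p)\le\pi_i(q)$ for all $i$. A grid is a poset isomorphic to a product $[a_1]\times\dots\times[a_k]$ of chains with the pointwise order; its size is the formal expression $a_1\times\dots\times a_k$. -}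

module Defs where

open import Data.Nat using (ℕ; zero; suc; _*_; _∸_; _/_) renaming (_≤_ to _≤ℕ_)
open import Data.Fin using (Fin; zero; suc) renaming (_≤_ to _≤F_)
open import Data.Product using (Σ; ∃; _×_; _,_)
open import Relation.Binary.PropositionalEquality using (_≡_)
open import Relation.Binary.Structures using (IsPartialOrder)
open import Function.Definitions using (Bijective; Injective)

record FinPoset : Set₁ where
  field
    size  : ℕ
    _≼_   : Fin size → Fin size → Set
    isPartialOrder : IsPartialOrder _≡_ _≼_

open FinPoset public

HasMinimum : FinPoset → Set
HasMinimum P = ∃ λ m → ∀ p → _≼_ P m p

HasMaximum : FinPoset → Set
HasMaximum P = ∃ λ M → ∀ p → _≼_ P p M

Realizer : FinPoset → ℕ → Set
Realizer P d =
  Σ (Fin d → Fin (size P) → Fin (size P)) λ π →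
    (∀ i → Bijective _≡_ _≡_ (π i)) ×
    (∀ p q → (_≼_ P p q → ∀ i → π i p ≤F π i q) × ((∀ i → π i p ≤F π i q) → _≼_ P p q))

-- d is the dimension of P: the least positive d admitting a realizer
-- (positivity convention: a one-element poset has dimension 1).
IsDimension : FinPoset → ℕ → Set
IsDimension P d = (1 ≤ℕ d) × Realizer P d × (∀ e → 1 ≤ℕ e → Realizer P e → d ≤ℕ e)

-- The grid [a_1] × … × [a_d] with the pointwise order (elements 0-indexed).
Grid : ∀ {d} → (Fin d → ℕ) → Set
Grid {d} a = (i : Fin d) → Fin (a i)

_≤G_ : ∀ {d} {a : Fin d → ℕ} → Grid a → Grid a → Set
_≤G_ {d} x y = (i : Fin d) → x i ≤F y i

prod : ∀ {d} → (Fin d → ℕ) → ℕ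
prod {zero}  a = 1
prod {suc d} a = a zero * prod {d} (λ i → a (suc i))

-- floor division, ⌊m / n⌋ (value for n = 0 irrelevant, never used)
divFloor : ℕ → ℕ → ℕ
divFloor m zero    = 0
divFloor m (suc k) = m / suc k

-- the size ⌊h_1/n⌋ × (h_2 − n) × … × (h_d − n)   (truncated subtraction)
gridSize : ∀ {d} → (Fin d → ℕ) → ℕ → Fin d → ℕ
gridSize h n zero    = divFloor (h zero) n
gridSize h n (suc j) = h (suc j) ∸ n

-- A copy of P in a grid H: the image of an order embedding
-- (p ≤ q iff e p ≤ e q); its induced subposet is isomorphic to P.
IsCopy : (P : FinPoset) → ∀ {d} {h : Fin d → ℕ} → (Fin (size P) → Grid h) → Set
IsCopy P e = ∀ p q → (_≼_ P p q → e p ≤G e q) × (e p ≤G e q → _≼_ P p q)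

IsMinOf : ∀ {n d} {h : Fin d → ℕ} → (Fin n → Grid h) → Grid h → Set
IsMinOf e x = (∃ λ p → e p ≡ x) × (∀ q → x ≤G e q)

IsMaxOf : ∀ {n d} {h : Fin d → ℕ} → (Fin n → Grid h) → Grid h → Set
IsMaxOf e x = (∃ λ p → e p ≡ x) × (∀ q → e q ≤G x)

FormsGrid : ∀ {d} {h : Fin d → ℕ} → (Grid h → Set) → (Fin d → ℕ) → Set
FormsGrid {d} {h} S a =
  Σ (Grid a → Grid h) λ φ →
    (∀ x y → (x ≤G y → φ x ≤G φ y) × (φ x ≤G φ y → x ≤G y)) ×
    (∀ x → S (φ x)) × (∀ y → S y → ∃ λ x → φ x ≡ y)

module Submission where

open import Defs
open import Data.Nat using (ℕ; _≤_; _∸_)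
open import Data.Fin using (Fin)
open import Data.Product using (Σ; ∃; _×_; _,_)
open import Relation.Binary.PropositionalEquality using (_≡_)
open import Function.Definitions using (Injective)

open import Data.Nat using (zero; suc; _+_; _*_; _<_; _/_; _%_; NonZero; z≤n)
open import Data.Nat.Properties
open import Data.Nat.DivMod using (m/n*n≤m; m≡m%n+[m/n]*n; m%n<n)
open import Data.Fin as F using (toℕ; inject≤; fromℕ<; combine; remQuot)
  renaming (zero to fz; suc to fs)
open import Data.Fin.Properties
  using (toℕ<n; toℕ-inject≤; toℕ-fromℕ<; toℕ-injective; inject≤-injective;
         toℕ-combine; combine-injective; remQuot-combine; combine-remQuot; nonZeroIndex)
open import Data.Product using (proj₁; proj₂; uncurry)
open import Relation.Binary.PropositionalEquality
  using (refl; sym; trans; cong; cong₂; subst; subst₂; module ≡-Reasoning)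
open import Relation.Binary.Structures using (IsPartialOrder)

-- Let N = |P| and let π₁ … π_d be a
-- realizer of P, so that p ↦ (π₁ p, …, π_d p) embeds P into the cube [N]^d.
-- For every g in the grid A = ⌊h₁/N⌋ × (h₂−N) × … × (h_d−N) we place the
-- translate
--     copyAt g p = (N·g₁ + π₁ p , g₂ + π₂ p , … , g_d + π_d p)
-- inside H.  Each copyAt g is a copy of P; along the first axis the copies
-- live in disjoint blocks of length N, which (with the realizer being
-- injective) makes the family disjoint; and g ↦ copyAt g p₀ is an order
-- embedding of A for any fixed p₀, so the minima (p₀ = min P) and the
-- maxima (p₀ = max P) of the copies form grids of size A.  Finally the copies
-- cover at least ∏ (hᵢ − N) points: splitting the first coordinate of a
-- point of ∏ [hᵢ − N] into (block, offset) maps it injectively to a point of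
-- one of the copies.

tail : ∀ {d} → (Fin (suc d) → ℕ) → Fin d → ℕ
tail a i = a (fs i)

decode : ∀ {d} {a : Fin d → ℕ} → Fin (prod a) → Grid a
decode {suc d} {a} c fz     = proj₁ (remQuot {a fz} (prod (tail a)) c)
decode {suc d} {a} c (fs i) = decode {d} {tail a} (proj₂ (remQuot {a fz} (prod (tail a)) c)) i

encode : ∀ {d} {a : Fin d → ℕ} → Grid a → Fin (prod a)
encode {zero}      x = fz
encode {suc d} {a} x = combine (x fz) (encode {d} {tail a} (λ i → x (fs i)))

encode-decode : ∀ {d} {a : Fin d → ℕ} (c : Fin (prod a)) → encode {d} {a} (decode c) ≡ c
encode-decode {zero}      fz = refl
encode-decode {suc d} {a} c
  rewrite encode-decode {d} {tail a} (proj₂ (remQuot {a fz} (prod (tail a)) c)) =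
    combine-remQuot {a fz} (prod (tail a)) c

-- decode ∘ encode is the identity, pointwise (there is no function extensionality).
decode-encode : ∀ {d} {a : Fin d → ℕ} (x : Grid a) i → decode {d} {a} (encode x) i ≡ x i
decode-encode {suc d} {a} x i = go i
  where
  split≡ : remQuot {a fz} (prod (tail a)) (encode x) ≡ (x fz , encode {d} {tail a} (λ j → x (fs j)))
  split≡ = remQuot-combine (x fz) _
  go : ∀ i → decode {suc d} {a} (encode x) i ≡ x i
  go fz     = cong proj₁ split≡
  go (fs i) = trans (cong (λ c → decode {d} {tail a} c i) (cong proj₂ split≡))
                    (decode-encode {d} {tail a} (λ j → x (fs j)) i)

encode-cong : ∀ {d} {a : Fin d → ℕ} {x y : Grid a} → (∀ i → x i ≡ y i) → encode x ≡ encode y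
encode-cong {zero}      e = refl
encode-cong {suc d} {a} e = cong₂ combine (e fz) (encode-cong {d} {tail a} (λ i → e (fs i)))

encode-injective : ∀ {d} {a : Fin d → ℕ} {x y : Grid a} → encode x ≡ encode y → ∀ i → x i ≡ y i
encode-injective {d} {a} {x} {y} e i =
  trans (sym (decode-encode x i)) (trans (cong (λ c → decode {d} {a} c i) e) (decode-encode y i))

decode-injective : ∀ {d} {a : Fin d → ℕ} {c c' : Fin (prod a)} →
  (∀ i → decode {d} {a} c i ≡ decode c' i) → c ≡ c'
decode-injective {d} {a} {c} {c'} e =
  trans (sym (encode-decode {d} {a} c)) (trans (encode-cong e) (encode-decode {d} {a} c'))

divFloor*≤ : ∀ m n → divFloor m n * n ≤ m
divFloor*≤ m zero    = z≤n
divFloor*≤ m (suc k) = m/n*n≤m m (suc k)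

∸≤divFloor* : ∀ m n .{{_ : NonZero n}} → m ∸ n ≤ divFloor m n * n
∸≤divFloor* m (suc k) = m≤n+o⇒m∸n≤o m (suc k) (begin
  m                              ≡⟨ m≡m%n+[m/n]*n m (suc k) ⟩
  m % suc k + m / suc k * suc k  ≤⟨ +-monoˡ-≤ _ (<⇒≤ (m%n<n m (suc k))) ⟩
  suc k + m / suc k * suc k      ∎)
  where open ≤-Reasoning

addFin : ∀ {m n} → Fin (m ∸ n) → Fin n → Fin m
addFin {m} {n} t x = fromℕ< (begin-strict
  toℕ t + toℕ x     <⟨ +-monoʳ-< (toℕ t) (toℕ<n x) ⟩
  toℕ t + n         ≤⟨ +-monoˡ-≤ n (<⇒≤ (toℕ<n t)) ⟩
  m ∸ n + n         ≡⟨ m∸n+n≡m n≤m ⟩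
  m                 ∎)
  where
  open ≤-Reasoning
  n≤m : n ≤ m
  n≤m = <⇒≤ (m∸n≢0⇒n<m (λ e → n≮0 (subst (toℕ t <_) e (toℕ<n t))))

module _ (P : FinPoset) {d} {h : Fin d → ℕ} {e : Fin (size P) → Grid h} (isCopy : IsCopy P e) where
  open IsPartialOrder (isPartialOrder P) using (antisym)

  copy-hasMin : ∀ {m} → (∀ p → _≼_ P m p) → IsMinOf e (e m)
  copy-hasMin least = (_ , refl) , λ q → proj₁ (isCopy _ q) (least q)

  copy-minUnique : ∀ {m y} → (∀ p → _≼_ P m p) → IsMinOf e y → e m ≡ y
  copy-minUnique {m} least ((p , refl) , below) =
    cong e (antisym (least p) (proj₂ (isCopy p m) (below m)))

  copy-hasMax : ∀ {M} → (∀ p → _≼_ P p M) → IsMaxOf e (e M)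
  copy-hasMax greatest = (_ , refl) , λ q → proj₁ (isCopy q _) (greatest q)

  copy-maxUnique : ∀ {M y} → (∀ p → _≼_ P p M) → IsMaxOf e y → e M ≡ y
  copy-maxUnique {M} greatest ((p , refl) , above) =
    cong e (antisym (proj₂ (isCopy M p) (above M)) (greatest p))

module Packing (P : FinPoset) {{N-nonZero : NonZero (size P)}} {d : ℕ}
               (realizer : Realizer P (suc d)) (h : Fin (suc d) → ℕ) where

  N : ℕ
  N = size P

  π : Fin (suc d) → Fin N → Fin N
  π = proj₁ realizer

  π-injective : ∀ i → Injective _≡_ _≡_ (π i)
  π-injective i = proj₁ (proj₁ (proj₂ realizer) i)

  π-realizes : ∀ p q → (_≼_ P p q → ∀ i → π i p F.≤ π i q) × ((∀ i → π i p F.≤ π i q) → _≼_ P p q)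
  π-realizes = proj₂ (proj₂ realizer)

  A : Fin (suc d) → ℕ
  A = gridSize h N

  -- The translate of the realizer embedding by g: first coordinate N·g₁ + π₁ p
  -- (block g₁ of length N), other coordinates gᵢ + πᵢ p.
  copyAt : Grid A → Fin N → Grid h
  copyAt g p fz     = inject≤ (combine (g fz) (π fz p)) (divFloor*≤ (h fz) N)
  copyAt g p (fs i) = addFin (g (fs i)) (π (fs i) p)

  scale : Fin (suc d) → ℕ
  scale fz     = N
  scale (fs _) = 1

  scale-nonZero : ∀ i → NonZero (scale i)
  scale-nonZero fz     = N-nonZero
  scale-nonZero (fs _) = _

  copyAt-coord : ∀ g p i → toℕ (copyAt g p i) ≡ scale i * toℕ (g i) + toℕ (π i p)
  copyAt-coord g p fz     = trans (toℕ-inject≤ _ _) (toℕ-combine (g fz) (π fz p))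
  copyAt-coord g p (fs i) = trans (toℕ-fromℕ< _) (cong (_+ toℕ (π (fs i) p)) (sym (*-identityˡ _)))

  copyAt-≤-point : ∀ g p q i → π i p F.≤ π i q → copyAt g p i F.≤ copyAt g q i
  copyAt-≤-point g p q i le =
    subst₂ _≤_ (sym (copyAt-coord g p i)) (sym (copyAt-coord g q i)) (+-monoʳ-≤ _ le)

  copyAt-≤-point⁻ : ∀ g p q i → copyAt g p i F.≤ copyAt g q i → π i p F.≤ π i q
  copyAt-≤-point⁻ g p q i le =
    +-cancelˡ-≤ _ _ _ (subst₂ _≤_ (copyAt-coord g p i) (copyAt-coord g q i) le)

  copyAt-≤-base : ∀ g g' p i → g i F.≤ g' i → copyAt g p i F.≤ copyAt g' p i
  copyAt-≤-base g g' p i le =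
    subst₂ _≤_ (sym (copyAt-coord g p i)) (sym (copyAt-coord g' p i))
      (+-monoˡ-≤ _ (*-monoʳ-≤ (scale i) le))

  copyAt-≤-base⁻ : ∀ g g' p i → copyAt g p i F.≤ copyAt g' p i → g i F.≤ g' i
  copyAt-≤-base⁻ g g' p i le =
    *-cancelˡ-≤ (scale i) {{scale-nonZero i}}
      (+-cancelʳ-≤ _ _ _ (subst₂ _≤_ (copyAt-coord g p i) (copyAt-coord g' p i) le))

  -- A point of H lies in at most one translate, at one position: the first
  -- coordinate determines π₁ p, hence p; then every coordinate determines gᵢ.
  copyAt-injective : ∀ g g' p q → copyAt g p ≡ copyAt g' q → (∀ i → g i ≡ g' i) × p ≡ q
  copyAt-injective g g' p q e = same-base , p≡q
    where
    p≡q : p ≡ q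
    p≡q = π-injective fz (proj₂ (combine-injective (g fz) (π fz p) (g' fz) (π fz q)
                                   (inject≤-injective _ _ _ _ (cong (λ x → x fz) e))))
    same-base : ∀ i → g i ≡ g' i
    same-base i = toℕ-injective (*-cancelˡ-≡ _ _ (scale i) {{scale-nonZero i}}
                                  (+-cancelʳ-≡ _ _ _ (begin
      scale i * toℕ (g i) + toℕ (π i p)   ≡⟨ sym (copyAt-coord g p i) ⟩
      toℕ (copyAt g p i)                  ≡⟨ cong (λ x → toℕ (x i)) e ⟩
      toℕ (copyAt g' q i)                 ≡⟨ copyAt-coord g' q i ⟩
      scale i * toℕ (g' i) + toℕ (π i q)  ≡⟨ cong (λ r → scale i * toℕ (g' i) + toℕ (π i r)) (sym p≡q) ⟩
      scale i * toℕ (g' i) + toℕ (π i p)  ∎)))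
      where open ≡-Reasoning

  𝒫 : Fin (prod A) → Fin N → Grid h
  𝒫 c = copyAt (decode c)

  𝒫-copy : ∀ c → IsCopy P (𝒫 c)
  𝒫-copy c p q =
    (λ p≼q i → copyAt-≤-point (decode c) p q i (proj₁ (π-realizes p q) p≼q i)) ,
    (λ le → proj₂ (π-realizes p q) (λ i → copyAt-≤-point⁻ (decode c) p q i (le i)))

  𝒫-disjoint : ∀ c c' p q → 𝒫 c p ≡ 𝒫 c' q → c ≡ c' × p ≡ q
  𝒫-disjoint c c' p q e =
    let (same-base , p≡q) = copyAt-injective (decode c) (decode c') p q e
    in decode-injective same-base , p≡q

  basePoints : Fin N → Grid A → Grid h
  basePoints p₀ x = 𝒫 (encode x) p₀

  basePoints-embedding : ∀ p₀ x y → (x ≤G y → basePoints p₀ x ≤G basePoints p₀ y) ×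
                                    (basePoints p₀ x ≤G basePoints p₀ y → x ≤G y)
  basePoints-embedding p₀ x y =
    (λ le i → copyAt-≤-base _ _ p₀ i (subst₂ F._≤_ (sym (decode-encode x i)) (sym (decode-encode y i)) (le i))) ,
    (λ le i → subst₂ F._≤_ (decode-encode x i) (decode-encode y i) (copyAt-≤-base⁻ _ _ p₀ i (le i)))

  basePoints-formGrid : (S : Grid h → Set) (p₀ : Fin N) →
    (∀ c → S (𝒫 c p₀)) → (∀ y → S y → ∃ λ c → 𝒫 c p₀ ≡ y) → FormsGrid S A
  basePoints-formGrid S p₀ inS onlyS =
    basePoints p₀ , basePoints-embedding p₀ , (λ x → inS (encode x)) ,
    λ y Sy → let (c , e) = onlyS y Sy
             in decode c , trans (cong (λ c' → 𝒫 c' p₀) (encode-decode {a = A} c)) e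

  minima-formGrid : ∀ {m} → (∀ p → _≼_ P m p) → FormsGrid (λ x → ∃ λ c → IsMinOf (𝒫 c) x) A
  minima-formGrid {m} least = basePoints-formGrid _ m
    (λ c → c , copy-hasMin P (𝒫-copy c) least)
    (λ { y (c , isMin) → c , copy-minUnique P (𝒫-copy c) least isMin })

  maxima-formGrid : ∀ {M} → (∀ p → _≼_ P p M) → FormsGrid (λ x → ∃ λ c → IsMaxOf (𝒫 c) x) A
  maxima-formGrid {M} greatest = basePoints-formGrid _ M
    (λ c → c , copy-hasMax P (𝒫-copy c) greatest)
    (λ { y (c , isMax) → c , copy-maxUnique P (𝒫-copy c) greatest isMax })

  -- Covering: a point x of ∏ [hᵢ − N] is sent to the point at position
  -- coveredOffset x of the translate coveredBase x, obtained by splitting the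
  -- first coordinate of x into a block of length N and an offset inside it.
  B : Fin (suc d) → ℕ
  B i = h i ∸ N

  blockOffset : Fin (h fz ∸ N) → Fin (A fz) × Fin N
  blockOffset v = remQuot {A fz} N (inject≤ v (∸≤divFloor* (h fz) N))

  blockOffset-injective : ∀ {v v'} → blockOffset v ≡ blockOffset v' → v ≡ v'
  blockOffset-injective {v} {v'} e = inject≤-injective _ _ v v'
    (trans (sym (combine-remQuot {A fz} N _)) (trans (cong (uncurry combine) e) (combine-remQuot {A fz} N _)))

  coveredBase : Grid B → Grid A
  coveredBase x fz     = proj₁ (blockOffset (x fz))
  coveredBase x (fs i) = x (fs i)

  coveredOffset : Grid B → Fin N
  coveredOffset x = proj₂ (blockOffset (x fz))

  covered : Fin (prod B) → Grid h
  covered j = 𝒫 (encode (coveredBase (decode j))) (coveredOffset (decode j))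

  covered-injective : Injective _≡_ _≡_ covered
  covered-injective {j} {j'} e = decode-injective same-point
    where
    sameCopy : encode (coveredBase (decode j)) ≡ encode (coveredBase (decode j')) ×
               coveredOffset (decode j) ≡ coveredOffset (decode j')
    sameCopy = 𝒫-disjoint _ _ _ _ e
    same-base : ∀ i → coveredBase (decode j) i ≡ coveredBase (decode j') i
    same-base = encode-injective {a = A} (proj₁ sameCopy)
    same-point : ∀ i → decode {a = B} j i ≡ decode {a = B} j' i
    same-point fz     = blockOffset-injective (cong₂ _,_ (same-base fz) (proj₂ sameCopy))
    same-point (fs i) = same-base (fs i)

-- The theorem: a nonempty poset has at least one point, and dimension ≥ 1, so
-- the packing above applies to a realizer of length d = dim P.

claim1 : (P : FinPoset) → HasMinimum P → HasMaximum P →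
    (d : ℕ) → IsDimension P d →
    (h : Fin d → ℕ) → (∀ i → 1 ≤ h i) →
    Σ ℕ λ c → Σ (Fin c → Fin (size P) → Grid h) λ 𝒫 →
      (∀ a → IsCopy P (𝒫 a)) ×
      (∀ a b p q → 𝒫 a p ≡ 𝒫 b q → a ≡ b) ×
      (Σ (Fin (prod (λ i → h i ∸ size P)) → Grid h) λ f →
         Injective _≡_ _≡_ f × (∀ j → ∃ λ a → ∃ λ p → 𝒫 a p ≡ f j)) ×
      FormsGrid (λ x → ∃ λ a → IsMinOf (𝒫 a) x) (gridSize h (size P)) ×
      FormsGrid (λ x → ∃ λ a → IsMaxOf (𝒫 a) x) (gridSize h (size P))
claim1 P _ _ zero (() , _) h _
claim1 P (m , least) (M , greatest) (suc d) (_ , realizer , _) h _ =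
  prod A , 𝒫 , 𝒫-copy , (λ c c' p q e → proj₁ (𝒫-disjoint c c' p q e)) ,
  (covered , covered-injective , λ j → _ , _ , refl) ,
  minima-formGrid least , maxima-formGrid greatest
  where
  instance
    P-nonempty : NonZero (size P)
    P-nonempty = nonZeroIndex m
  open Packing P realizer h
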